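{- Let $L\subseteq\{0,1\}^*$ be a finite language. Then the graph class $\mathcal{G}_{\langle L\rangle}$ has speed at most $2^{O(n\log n)}$, i.e., there is a constant $c>0$ (depending only on $L$) such that $|\mathcal{G}_{\langle L\rangle}^n|\le n^{cn}$ for all $n\ge 2$; hence $\mathcal{G}_{\langle L\rangle}$ has at most factorial speed.
   Context: For a binary word $u$, $\widetilde{u}$ denotes the word obtained by exchanging $0$ and $1$. For $L\subseteq\{0,1\}^*$, $\langle L\rangle=\{u,\widetilde u\mid u\in L\}$; $L$ is 0-1-symmetric if $L=\langle L\rangle$. For a word $w$ and distinct letters $a,b$, $h_{a,b}(w)\in\{0,1\}^*$ is obtained from $w$ by replacing each $a$ by $0$, each $b$ by $1$, and deleting all other letters. For a 0-1-symmetric $L$ and a word $w$ whose set of occurring letters is $V$, $G(L,w)$ is the graph with vertex set $V$ in which distinct $u,v\in V$ are adjacent iff $h_{u,v}(w)\in L$. $\mathcal{G}_L$ is the class of all graphs isomorphic to $G(L,w)$ for some word $w$. For a graph class $\mathcal{C}$ (closed under isomorphism), $\mathcal{C}^n$ is the set of graphs in $\mathcal{C}$ with vertex set $\{1,\dots,n\}$ and $n\mapsto|\mathcal{C}^n|$ is the speed of $\mathcal{C}$. $\mathcal{C}$ has at most factorial speed if there is $c>0$ with $|\mathcal{C}^n|\le n^{cn}$. -}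

module Defs where

open import Data.Bool using (Bool; true; false; not)
open import Data.Nat using (ℕ; _≟_)
open import Data.Fin using (Fin)
open import Data.List using (List; []; _∷_; map)
open import Data.List.Membership.Propositional using (_∈_)
open import Data.Product using (Σ; ∃; _×_; _,_)
open import Data.Sum using (_⊎_)
open import Function using (_⇔_)
open import Function.Definitions using (Injective)
open import Relation.Nullary using (¬_; yes; no)
open import Relation.Binary.PropositionalEquality using (_≡_)

-- Binary words: 0 = false, 1 = true.
BinWord : Set
BinWord = List Bool

Language : Set
Language = List BinWord

flipWord : BinWord → BinWord
flipWord = map not

_∈⟨_⟩ : BinWord → Language → Set
u ∈⟨ L ⟩ = (u ∈ L) ⊎ (flipWord u ∈ L)

-- Words over an arbitrary (countable) alphabet: letters are natural numbers.
Word : Set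
Word = List ℕ

h : ℕ → ℕ → Word → BinWord
h a b [] = []
h a b (x ∷ w) with x ≟ a
... | yes _ = false ∷ h a b w
... | no _ with x ≟ b
...   | yes _ = true ∷ h a b w
...   | no _ = h a b w

-- Labelled graphs on vertex set {1,…,n} (represented by Fin n), given by
-- their adjacency function.
Graph : ℕ → Set
Graph n = Fin n → Fin n → Bool

-- G ∈ 𝒢_{⟨L⟩}^n : G is isomorphic to G(⟨L⟩, w) for some word w.
-- The isomorphism is an injection f : Fin n → ℕ whose image is exactly the
-- set of letters occurring in w, such that i,j are adjacent in G iff
-- f i, f j are distinct and h_{f i, f j}(w) ∈ ⟨L⟩.
InClass : Language → (n : ℕ) → Graph n → Set
InClass L n G =
  Σ Word λ w → Σ (Fin n → ℕ) λ f →
    Injective _≡_ _≡_ f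
    × (∀ x → x ∈ w → ∃ λ i → f i ≡ x)
    × (∀ i → f i ∈ w)
    × (∀ i j → (G i j ≡ true) ⇔ ((¬ i ≡ j) × (h (f i) (f j) w ∈⟨ L ⟩)))

_≈G_ : ∀ {n} → Graph n → Graph n → Set
G ≈G H = ∀ i j → G i j ≡ H i j

-- Relabel the letters of w as 0, …, n-1 so that vertex i is the letter i, and let m be the
-- maximal length of a word of L. Since h_{a,b}(w) contains every occurrence of a and of b,
-- a letter occurring more than m times is isolated. Keeping only the last m+1 occurrences of
-- every letter therefore leaves h_{a,b} unchanged between letters occurring at most m times
-- and keeps all other letters isolated, so it preserves the graph. The result has length at
-- most (m+1)n; padded with the new letter n it becomes a word of {0,…,n}^((m+1)n) from which
-- the graph can be read off. Hence there are at most (n+1)^((m+1)n) ≤ n^(2(m+1)n) graphs.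

{-# OPTIONS --safe #-}
module Submission where

open import Defs
open import Data.Bool using (true; false; not)
import Data.Bool
open import Data.Bool.Properties using (T-≡)
open import Data.Nat using (ℕ; zero; suc; _+_; _*_; _^_; _∸_; _⊓_; _≤_; _<_; z≤n; s≤s; _≟_; _<?_; _≤?_)
open import Data.Nat.Properties
open import Data.Fin as Fin using (Fin; toℕ)
open import Data.Fin.Properties using (any?; toℕ-injective; toℕ<n)
open import Data.List using (List; []; _∷_; [_]; _++_; length; map; replicate; filter; upTo; cartesianProductWith)
open import Data.List.Properties
  using (length-++; length-map; length-replicate; length-upTo; filter-accept; filter-reject; ++-identityʳ; ≡-dec)
open import Data.List.Extrema.Nat using (argmax; f[xs]≤f[argmax])
open import Data.List.Relation.Unary.All as All using (All; []; _∷_)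
open import Data.List.Relation.Unary.All.Properties using (all-filter)
  renaming (filter⁺ to All-filter⁺; map⁺ to All-map⁺; ++⁺ to All-++⁺; replicate⁺ to All-replicate⁺)
open import Data.List.Relation.Unary.Any using (here; there)
open import Data.List.Membership.Propositional using (_∈_)
open import Data.List.Membership.Propositional.Properties using (∈-map⁺; ∈-upTo⁺; ∈-cartesianProductWith⁺)
open import Data.List.Membership.DecPropositional (≡-dec Data.Bool._≟_) using (_∈?_)
open import Data.List.Relation.Binary.Sublist.Propositional using (_⊆_; []; _∷ʳ_; _∷_; ⊆-refl)
open import Data.List.Relation.Binary.Sublist.Propositional.Properties
  using (filter-⊆; All-resp-⊆) renaming (filter⁺ to ⊆-filter⁺)
open import Data.List.Relation.Binary.Sublist.Heterogeneous.Properties using (length-mono-≤)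
open import Data.Product using (Σ; ∃; _×_; _,_)
open import Data.Sum using (inj₁; inj₂)
open import Function using (_∘_; _⇔_; mk⇔; Equivalence)
open import Function.Definitions using (Injective)
import Function.Properties.Equivalence as ⇔
open import Relation.Nullary using (¬_; Dec; yes; no; does; contradiction)
open import Relation.Nullary.Decidable using (¬?; _×-dec_; _⊎-dec_; T?; does-⇔)
open import Relation.Unary using (Pred; Decidable)
open import Relation.Binary.PropositionalEquality
  using (_≡_; _≢_; refl; sym; trans; cong; cong₂; subst; subst₂; module ≡-Reasoning)

length-filter+∁ : ∀ {a p} {A : Set a} {P : Pred A p} (P? : Decidable P) xs →
  length (filter P? xs) + length (filter (¬? ∘ P?) xs) ≡ length xs
length-filter+∁ P? [] = refl
length-filter+∁ P? (x ∷ xs) with does (P? x)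
... | true = cong suc (length-filter+∁ P? xs)
... | false = trans (+-suc _ _) (cong suc (length-filter+∁ P? xs))

occ : ℕ → Word → ℕ
occ c w = length (filter (_≟ c) w)

occ-here : ∀ x w → occ x (x ∷ w) ≡ suc (occ x w)
occ-here x w = cong length (filter-accept (_≟ x) refl)

occ-there : ∀ {c x} w → x ≢ c → occ c (x ∷ w) ≡ occ c w
occ-there w x≢c = cong length (filter-reject (_≟ _) x≢c)

occ-mono : ∀ c {u w} → u ⊆ w → occ c u ≤ occ c w
occ-mono c u⊆w = length-mono-≤ (⊆-filter⁺ (_≟ c) (_≟ c) (λ { refl p → p }) u⊆w)

occ-∷≤⇒occ≤ : ∀ c x w {k} → occ c (x ∷ w) ≤ k → occ c w ≤ k
occ-∷≤⇒occ≤ c x w = ≤-trans (occ-mono c (x ∷ʳ ⊆-refl))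

length≤*-occ : ∀ k n {w} → All (_< n) w → (∀ c → occ c w ≤ k) → length w ≤ k * n
length≤*-occ k zero [] _ = z≤n
length≤*-occ k (suc n) {w} w<1+n occ≤k = begin
  length w                     ≡⟨ length-filter+∁ (_≟ n) w ⟨
  occ n w + length others      ≤⟨ +-mono-≤ (occ≤k n) (length≤*-occ k n others<n others-occ≤k) ⟩
  k + k * n                    ≡⟨ *-suc k n ⟨
  k * suc n                    ∎
  where
  open ≤-Reasoning
  others : Word
  others = filter (¬? ∘ (_≟ n)) w
  others<n : All (_< n) others
  others<n = All.zipWith (λ (x<1+n , x≢n) → ≤∧≢⇒< (m<1+n⇒m≤n x<1+n) x≢n)
    (All-filter⁺ (¬? ∘ (_≟ n)) w<1+n , all-filter (¬? ∘ (_≟ n)) w)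
  others-occ≤k : ∀ c → occ c others ≤ k
  others-occ≤k c = ≤-trans (occ-mono c (filter-⊆ (¬? ∘ (_≟ n)) w)) (occ≤k c)

h-++ : ∀ a b u v → h a b (u ++ v) ≡ h a b u ++ h a b v
h-++ a b [] v = refl
h-++ a b (x ∷ u) v with x ≟ a
... | yes _ = cong (false ∷_) (h-++ a b u v)
... | no _ with x ≟ b
...   | yes _ = cong (true ∷_) (h-++ a b u v)
...   | no _ = h-++ a b u v

h-∷ : ∀ a b x w → h a b (x ∷ w) ≡ h a b [ x ] ++ h a b w
h-∷ a b x = h-++ a b [ x ]

h-singleton-foreign : ∀ {a b x} → x ≢ a → x ≢ b → h a b [ x ] ≡ []
h-singleton-foreign {a} {b} {x} x≢a x≢b with x ≟ a
... | yes x≡a = contradiction x≡a x≢a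
... | no _ with x ≟ b
...   | yes x≡b = contradiction x≡b x≢b
...   | no _ = refl

h-singleton-cong : ∀ {a b x a′ b′ y} → (x ≡ a ⇔ y ≡ a′) → (x ≡ b ⇔ y ≡ b′) →
  h a b [ x ] ≡ h a′ b′ [ y ]
h-singleton-cong {a} {b} {x} {a′} {b′} {y} ⇔a ⇔b with x ≟ a | y ≟ a′
... | yes _ | yes _ = refl
... | yes x≡a | no y≢a′ = contradiction (Equivalence.to ⇔a x≡a) y≢a′
... | no x≢a | yes y≡a′ = contradiction (Equivalence.from ⇔a y≡a′) x≢a
... | no _ | no _ with x ≟ b | y ≟ b′
...   | yes _ | yes _ = refl
...   | yes x≡b | no y≢b′ = contradiction (Equivalence.to ⇔b x≡b) y≢b′
...   | no x≢b | yes y≡b′ = contradiction (Equivalence.from ⇔b y≡b′) x≢b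
...   | no _ | no _ = refl

h-replicate : ∀ {a b c} k → c ≢ a → c ≢ b → h a b (replicate k c) ≡ []
h-replicate zero c≢a c≢b = refl
h-replicate {a} {b} {c} (suc k) c≢a c≢b = begin
  h a b (c ∷ replicate k c)              ≡⟨ h-∷ a b c (replicate k c) ⟩
  h a b [ c ] ++ h a b (replicate k c)
    ≡⟨ cong (_++ h a b (replicate k c)) (h-singleton-foreign c≢a c≢b) ⟩
  h a b (replicate k c)                  ≡⟨ h-replicate k c≢a c≢b ⟩
  []                                     ∎
  where open ≡-Reasoning

h-map : ∀ (g : ℕ → ℕ) a b w →
  (∀ {x} → x ∈ w → g x ≡ g a → x ≡ a) → (∀ {x} → x ∈ w → g x ≡ g b → x ≡ b) →
  h (g a) (g b) (map g w) ≡ h a b w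
h-map g a b [] _ _ = refl
h-map g a b (x ∷ w) a-only b-only = begin
  h (g a) (g b) (g x ∷ map g w)                  ≡⟨ h-∷ (g a) (g b) (g x) (map g w) ⟩
  h (g a) (g b) [ g x ] ++ h (g a) (g b) (map g w)
    ≡⟨ cong₂ _++_ (h-singleton-cong (reflects a-only) (reflects b-only))
                  (h-map g a b w (a-only ∘ there) (b-only ∘ there)) ⟩
  h a b [ x ] ++ h a b w                          ≡⟨ h-∷ a b x w ⟨
  h a b (x ∷ w)                                   ∎
  where
  open ≡-Reasoning
  reflects : ∀ {c} → (∀ {y} → y ∈ x ∷ w → g y ≡ g c → y ≡ c) → g x ≡ g c ⇔ x ≡ c
  reflects c-only = mk⇔ (c-only (here refl)) (cong g)

length-h : ∀ {a b} w → a ≢ b → length (h a b w) ≡ occ a w + occ b w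
length-h [] a≢b = refl
length-h {a} {b} (x ∷ w) a≢b with x ≟ a
... | yes refl = begin
  suc (length (h x b w))             ≡⟨ cong suc (length-h w a≢b) ⟩
  suc (occ x w) + occ b w            ≡⟨ cong₂ _+_ (occ-here x w) (occ-there w a≢b) ⟨
  occ x (x ∷ w) + occ b (x ∷ w)      ∎
  where open ≡-Reasoning
... | no x≢a with x ≟ b
...   | yes refl = begin
  suc (length (h a x w))             ≡⟨ cong suc (length-h w a≢b) ⟩
  suc (occ a w + occ x w)            ≡⟨ +-suc (occ a w) (occ x w) ⟨
  occ a w + suc (occ x w)            ≡⟨ cong₂ _+_ (occ-there w x≢a) (occ-here x w) ⟨
  occ a (x ∷ w) + occ x (x ∷ w)      ∎
  where open ≡-Reasoning
...   | no x≢b = trans (length-h w a≢b) (sym (cong₂ _+_ (occ-there w x≢a) (occ-there w x≢b)))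

keepAtMost : ℕ → Word → Word
keepAtMost k [] = []
keepAtMost k (x ∷ w) with occ x w <? k
... | yes _ = x ∷ keepAtMost k w
... | no _ = keepAtMost k w

keepAtMost-⊆ : ∀ k w → keepAtMost k w ⊆ w
keepAtMost-⊆ k [] = []
keepAtMost-⊆ k (x ∷ w) with occ x w <? k
... | yes _ = refl ∷ keepAtMost-⊆ k w
... | no _ = x ∷ʳ keepAtMost-⊆ k w

occ-keepAtMost : ∀ k c w → occ c (keepAtMost k w) ≡ k ⊓ occ c w
occ-keepAtMost k c [] = sym (⊓-zeroʳ k)
occ-keepAtMost k c (x ∷ w) with occ x w <? k | x ≟ c
... | yes o<k | yes refl = begin
  occ x (x ∷ keepAtMost k w)  ≡⟨ occ-here x (keepAtMost k w) ⟩
  suc (occ x (keepAtMost k w)) ≡⟨ cong suc (occ-keepAtMost k x w) ⟩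
  suc (k ⊓ occ x w)           ≡⟨ cong suc (m≥n⇒m⊓n≡n (<⇒≤ o<k)) ⟩
  suc (occ x w)               ≡⟨ m≥n⇒m⊓n≡n o<k ⟨
  k ⊓ suc (occ x w)           ≡⟨ cong (k ⊓_) (occ-here x w) ⟨
  k ⊓ occ x (x ∷ w)           ∎
  where open ≡-Reasoning
... | no o≮k | yes refl = begin
  occ x (keepAtMost k w)      ≡⟨ occ-keepAtMost k x w ⟩
  k ⊓ occ x w                 ≡⟨ m≤n⇒m⊓n≡m (≮⇒≥ o≮k) ⟩
  k                           ≡⟨ m≤n⇒m⊓n≡m (m≤n⇒m≤1+n (≮⇒≥ o≮k)) ⟨
  k ⊓ suc (occ x w)           ≡⟨ cong (k ⊓_) (occ-here x w) ⟨
  k ⊓ occ x (x ∷ w)           ∎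
  where open ≡-Reasoning
... | yes _ | no x≢c = trans (occ-there (keepAtMost k w) x≢c)
                             (trans (occ-keepAtMost k c w) (cong (k ⊓_) (sym (occ-there w x≢c))))
... | no _ | no x≢c = trans (occ-keepAtMost k c w) (cong (k ⊓_) (sym (occ-there w x≢c)))

h-keepAtMost : ∀ {k a b} w → occ a w ≤ k → occ b w ≤ k → h a b (keepAtMost k w) ≡ h a b w
h-keepAtMost [] _ _ = refl
h-keepAtMost {k} {a} {b} (x ∷ w) a≤k b≤k with occ x w <? k
... | yes _ = begin
  h a b (x ∷ keepAtMost k w)              ≡⟨ h-∷ a b x (keepAtMost k w) ⟩
  h a b [ x ] ++ h a b (keepAtMost k w)
    ≡⟨ cong (h a b [ x ] ++_) (h-keepAtMost w (occ-∷≤⇒occ≤ a x w a≤k) (occ-∷≤⇒occ≤ b x w b≤k)) ⟩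
  h a b [ x ] ++ h a b w                  ≡⟨ h-∷ a b x w ⟨
  h a b (x ∷ w)                           ∎
  where open ≡-Reasoning
... | no o≮k = begin
  h a b (keepAtMost k w)
    ≡⟨ h-keepAtMost w (occ-∷≤⇒occ≤ a x w a≤k) (occ-∷≤⇒occ≤ b x w b≤k) ⟩
  h a b w
    ≡⟨ cong (_++ h a b w) (h-singleton-foreign (dropped a≤k) (dropped b≤k)) ⟨
  h a b [ x ] ++ h a b w   ≡⟨ h-∷ a b x w ⟨
  h a b (x ∷ w)            ∎
  where
  open ≡-Reasoning
  dropped : ∀ {c} → occ c (x ∷ w) ≤ k → x ≢ c
  dropped c≤k refl = o≮k (subst (_≤ k) (occ-here x w) c≤k)

maxLength : Language → ℕ
maxLength L = length (argmax length [] L)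

length≤maxLength : ∀ {u} L → u ∈⟨ L ⟩ → length u ≤ maxLength L
length≤maxLength L (inj₁ u∈L) = All.lookup (f[xs]≤f[argmax] {f = length} [] L) u∈L
length≤maxLength {u} L (inj₂ ũ∈L) =
  subst (_≤ maxLength L) (length-map not u) (All.lookup (f[xs]≤f[argmax] {f = length} [] L) ũ∈L)

_∈⟨_⟩? : ∀ u L → Dec (u ∈⟨ L ⟩)
u ∈⟨ L ⟩? = (u ∈? L) ⊎-dec (flipWord u ∈? L)

∈⟨⟩⇒occ≤ : ∀ {a b} L w → a ≢ b → h a b w ∈⟨ L ⟩ → occ a w ≤ maxLength L × occ b w ≤ maxLength L
∈⟨⟩⇒occ≤ {a} {b} L w a≢b hw∈L = m+n≤o⇒m≤o _ occ≤ , m+n≤o⇒n≤o _ occ≤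
  where
  occ≤ : occ a w + occ b w ≤ maxLength L
  occ≤ = subst (_≤ maxLength L) (length-h w a≢b) (length≤maxLength L hw∈L)

occ-keepAtMost-≤ : ∀ m c w → occ c (keepAtMost (suc m) w) ≤ m → occ c w ≤ m
occ-keepAtMost-≤ m c w kept≤m with occ c w ≤? m
... | yes o≤m = o≤m
... | no o≰m = contradiction (subst (_≤ m) kept≡1+m kept≤m) 1+n≰n
  where
  kept≡1+m : occ c (keepAtMost (suc m) w) ≡ suc m
  kept≡1+m = trans (occ-keepAtMost (suc m) c w) (m≤n⇒m⊓n≡m (≰⇒> o≰m))

h-keepAtMost-∈⟨⟩ : ∀ {a b} L w → a ≢ b →
  h a b (keepAtMost (suc (maxLength L)) w) ∈⟨ L ⟩ ⇔ h a b w ∈⟨ L ⟩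
h-keepAtMost-∈⟨⟩ {a} {b} L w a≢b = mk⇔ to from
  where
  m : ℕ
  m = maxLength L
  kept : Word
  kept = keepAtMost (suc m) w
  same : occ a w ≤ m → occ b w ≤ m → h a b kept ≡ h a b w
  same a≤m b≤m = h-keepAtMost w (m≤n⇒m≤1+n a≤m) (m≤n⇒m≤1+n b≤m)
  to : h a b kept ∈⟨ L ⟩ → h a b w ∈⟨ L ⟩
  to kept∈L with ∈⟨⟩⇒occ≤ L kept a≢b kept∈L
  ... | a≤m , b≤m = subst (_∈⟨ L ⟩) (same (occ-keepAtMost-≤ m a w a≤m) (occ-keepAtMost-≤ m b w b≤m)) kept∈L
  from : h a b w ∈⟨ L ⟩ → h a b kept ∈⟨ L ⟩
  from w∈L with ∈⟨⟩⇒occ≤ L w a≢b w∈L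
  ... | a≤m , b≤m = subst (_∈⟨ L ⟩) (sym (same a≤m b≤m)) w∈L

padTo : ℕ → ℕ → Word → Word
padTo K c u = u ++ replicate (K ∸ length u) c

length-padTo : ∀ {K} c u → length u ≤ K → length (padTo K c u) ≡ K
length-padTo {K} c u u≤K = begin
  length (u ++ replicate (K ∸ length u) c)        ≡⟨ length-++ u ⟩
  length u + length (replicate (K ∸ length u) c)
    ≡⟨ cong (length u +_) (length-replicate (K ∸ length u)) ⟩
  length u + (K ∸ length u)                       ≡⟨ m+[n∸m]≡n u≤K ⟩
  K                                               ∎
  where open ≡-Reasoning

h-padTo : ∀ {a b c} K u → c ≢ a → c ≢ b → h a b (padTo K c u) ≡ h a b u
h-padTo {a} {b} {c} K u c≢a c≢b = begin
  h a b (u ++ replicate (K ∸ length u) c)           ≡⟨ h-++ a b u _ ⟩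
  h a b u ++ h a b (replicate (K ∸ length u) c)
    ≡⟨ cong (h a b u ++_) (h-replicate (K ∸ length u) c≢a c≢b) ⟩
  h a b u ++ []                                     ≡⟨ ++-identityʳ (h a b u) ⟩
  h a b u                                           ∎
  where open ≡-Reasoning

module _ {A : Set} where

  words : ℕ → List A → List (List A)
  words zero xs = [ [] ]
  words (suc k) xs = cartesianProductWith _∷_ xs (words k xs)

  length-cartesianProductWith : ∀ {B C : Set} (f : A → B → C) xs ys →
    length (cartesianProductWith f xs ys) ≡ length xs * length ys
  length-cartesianProductWith f [] ys = refl
  length-cartesianProductWith f (x ∷ xs) ys = begin
    length (map (f x) ys ++ cartesianProductWith f xs ys)          ≡⟨ length-++ (map (f x) ys) ⟩
    length (map (f x) ys) + length (cartesianProductWith f xs ys)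
      ≡⟨ cong₂ _+_ (length-map (f x) ys) (length-cartesianProductWith f xs ys) ⟩
    length ys + length xs * length ys                              ∎
    where open ≡-Reasoning

  length-words : ∀ k xs → length (words k xs) ≡ length xs ^ k
  length-words zero xs = refl
  length-words (suc k) xs =
    trans (length-cartesianProductWith _∷_ xs (words k xs)) (cong (length xs *_) (length-words k xs))

  ∈-words : ∀ {xs} w → All (_∈ xs) w → w ∈ words (length w) xs
  ∈-words [] [] = here refl
  ∈-words (x ∷ w) (x∈xs ∷ w⊆xs) = ∈-cartesianProductWith⁺ _∷_ x∈xs (∈-words w w⊆xs)

module _ {n} (f : Fin n → ℕ) where

  index : ℕ → ℕ
  index x with any? (λ i → f i ≟ x)
  ... | yes (i , _) = toℕ i
  ... | no _ = n

  index<n : ∀ {x} → (∃ λ i → f i ≡ x) → index x < n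
  index<n {x} x∈f with any? (λ i → f i ≟ x)
  ... | yes (i , _) = toℕ<n i
  ... | no ∄i = contradiction x∈f ∄i

  index-f : Injective _≡_ _≡_ f → ∀ i → index (f i) ≡ toℕ i
  index-f f-inj i with any? (λ k → f k ≟ f i)
  ... | yes (k , fk≡fi) = cong toℕ (f-inj fk≡fi)
  ... | no ∄k = contradiction (i , refl) ∄k

adjacent? : ∀ L {n} z (i j : Fin n) → Dec (i ≢ j × h (toℕ i) (toℕ j) z ∈⟨ L ⟩)
adjacent? L z i j = ¬? (i Fin.≟ j) ×-dec (h (toℕ i) (toℕ j) z ∈⟨ L ⟩?)

graphOf : Language → (n : ℕ) → Word → Graph n
graphOf L n z i j = does (adjacent? L z i j)

≈graphOf : ∀ L {n} (G : Graph n) z →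
  (∀ i j → G i j ≡ true ⇔ (i ≢ j × h (toℕ i) (toℕ j) z ∈⟨ L ⟩)) → G ≈G graphOf L n z
≈graphOf L G z G⇔ i j = does-⇔ (⇔.trans T-≡ (G⇔ i j)) (T? (G i j)) (adjacent? L z i j)

module Encoding (L : Language) {n} {w : Word} {f : Fin n → ℕ}
  (f-inj : Injective _≡_ _≡_ f) (f-onto : ∀ x → x ∈ w → ∃ λ i → f i ≡ x) where

  m : ℕ
  m = maxLength L

  relabelled : Word
  relabelled = map (index f) w

  truncated : Word
  truncated = keepAtMost (suc m) relabelled

  code : Word
  code = padTo (suc m * n) n truncated

  relabelled<n : All (_< n) relabelled
  relabelled<n = All-map⁺ (All.tabulate (index<n f ∘ f-onto _))

  truncated<n : All (_< n) truncated
  truncated<n = All-resp-⊆ (keepAtMost-⊆ (suc m) relabelled) relabelled<n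

  length-truncated : length truncated ≤ suc m * n
  length-truncated = length≤*-occ (suc m) n truncated<n λ c →
    subst (_≤ suc m) (sym (occ-keepAtMost (suc m) c relabelled)) (m⊓n≤m (suc m) _)

  code<1+n : All (_< suc n) code
  code<1+n = All-++⁺ (All.map m≤n⇒m≤1+n truncated<n) (All-replicate⁺ _ ≤-refl)

  code∈words : code ∈ words (suc m * n) (upTo (suc n))
  code∈words = subst (λ K → code ∈ words K (upTo (suc n))) (length-padTo n truncated length-truncated)
    (∈-words code (All.map ∈-upTo⁺ code<1+n))

  h-relabelled : ∀ i j → h (toℕ i) (toℕ j) relabelled ≡ h (f i) (f j) w
  h-relabelled i j =
    subst₂ (λ a b → h a b relabelled ≡ h (f i) (f j) w) (index-f f f-inj i) (index-f f f-inj j)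
      (h-map (index f) (f i) (f j) w (only i) (only j))
    where
    only : ∀ i {x} → x ∈ w → index f x ≡ index f (f i) → x ≡ f i
    only i x∈w same with f-onto _ x∈w
    ... | k , refl =
      cong f (toℕ-injective (trans (sym (index-f f f-inj k)) (trans same (index-f f f-inj i))))

  h-code : ∀ {i j} → i ≢ j → h (toℕ i) (toℕ j) code ∈⟨ L ⟩ ⇔ h (f i) (f j) w ∈⟨ L ⟩
  h-code {i} {j} i≢j
    rewrite h-padTo (suc m * n) truncated (<⇒≢ (toℕ<n i) ∘ sym) (<⇒≢ (toℕ<n j) ∘ sym)
          | sym (h-relabelled i j)
    = h-keepAtMost-∈⟨⟩ L relabelled (i≢j ∘ toℕ-injective)

graphsOf : Language → (n : ℕ) → List (Graph n)
graphsOf L n = map (graphOf L n) (words (suc (maxLength L) * n) (upTo (suc n)))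

InClass⇒∈graphsOf : ∀ L n (G : Graph n) → InClass L n G → ∃ λ H → H ∈ graphsOf L n × G ≈G H
-- The vertices need not all occur in w: the adjacency is read off G⇔ alone.
InClass⇒∈graphsOf L n G (w , f , f-inj , f-onto , _ , G⇔) =
  graphOf L n code , ∈-map⁺ (graphOf L n) code∈words , ≈graphOf L G code adjacency
  where
  open Encoding L f-inj f-onto
  adjacency : ∀ i j → G i j ≡ true ⇔ (i ≢ j × h (toℕ i) (toℕ j) code ∈⟨ L ⟩)
  adjacency i j = ⇔.trans (G⇔ i j) (mk⇔
    (λ (i≢j , hw∈L) → i≢j , Equivalence.from (h-code i≢j) hw∈L)
    (λ (i≢j , hcode∈L) → i≢j , Equivalence.to (h-code i≢j) hcode∈L))

suc-^≤^-2* : ∀ {n} e → 2 ≤ n → suc n ^ e ≤ n ^ (2 * e)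
suc-^≤^-2* {n} e 2≤n = begin
  suc n ^ e     ≤⟨ ^-monoˡ-≤ e suc≤square ⟩
  (n ^ 2) ^ e   ≡⟨ ^-*-assoc n 2 e ⟩
  n ^ (2 * e)   ∎
  where
  open ≤-Reasoning
  suc≤square : suc n ≤ n ^ 2
  suc≤square = begin
    suc n         ≤⟨ +-monoˡ-≤ n (≤-trans (s≤s z≤n) 2≤n) ⟩
    n + n         ≡⟨ cong (n +_) (+-identityʳ n) ⟨
    2 * n         ≤⟨ *-monoˡ-≤ n 2≤n ⟩
    n * n         ≡⟨ cong (n *_) (^-identityʳ n) ⟨
    n ^ 2         ∎

length-graphsOf : ∀ L {n} → 2 ≤ n → length (graphsOf L n) ≤ n ^ (2 * suc (maxLength L) * n)
length-graphsOf L {n} 2≤n = begin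
  length (graphsOf L n)                  ≡⟨ length-map (graphOf L n) (words K (upTo (suc n))) ⟩
  length (words K (upTo (suc n)))        ≡⟨ length-words K (upTo (suc n)) ⟩
  length (upTo (suc n)) ^ K              ≡⟨ cong (_^ K) (length-upTo (suc n)) ⟩
  suc n ^ K                              ≤⟨ suc-^≤^-2* K 2≤n ⟩
  n ^ (2 * K)                            ≡⟨ cong (n ^_) (*-assoc 2 (suc (maxLength L)) n) ⟨
  n ^ (2 * suc (maxLength L) * n)        ∎
  where
  open ≤-Reasoning
  K : ℕ
  K = suc (maxLength L) * n

theorem1 : (L : Language) →
    ∃ λ (c : ℕ) → (1 ≤ c) ×
      (∀ (n : ℕ) → 2 ≤ n →
        Σ (List (Graph n)) λ gs →
          (length gs ≤ n ^ (c * n))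
          × (∀ (G : Graph n) → InClass L n G → ∃ λ H → (H ∈ gs) × (G ≈G H)))
theorem1 L = 2 * suc (maxLength L) , s≤s z≤n ,
  λ n 2≤n → graphsOf L n , length-graphsOf L 2≤n , InClass⇒∈graphsOf L n
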